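{- For every positive integer $n$, the rank of a permutation in $S_n$ is $\frac{n!+1}{2}$-mesic with respect to the Lehmer code rotation.
   Context: A statistic $f$ is $c$-mesic with respect to a bijection $\mathcal{X}$ of a finite set if its average over every orbit of $\mathcal{X}$ equals $c$. The rank of $\sigma\in S_n$ is its position (an integer from $1$ to $n!$) among all permutations of $[n]$ in lexicographic order of their one-line notations. Lehmer code: $L(\sigma)_i=\#\{j>i:\sigma_j<\sigma_i\}\in\{0,\dots,n-i\}$, a bijection from $S_n$ to such tuples; the Lehmer code rotation sends $\sigma$ to the unique $\tau$ with $L(\tau)_i\equiv L(\sigma)_i+1\pmod{n-i+1}$ for all $i$. -}

module Defs where

open import Data.Nat using (ℕ; zero; suc; _+_; _*_; _<_; _<?_; _%_)
open import Data.Fin using (Fin; toℕ)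
open import Data.Fin.Properties using (_≟_)
open import Data.Vec using (Vec; []; _∷_; toList)
open import Data.List using (List; []; _∷_; length; map; concatMap; filter; upTo; allFin)
open import Data.List.Relation.Unary.Unique.Propositional using (Unique)
import Data.List.Relation.Unary.Unique.DecPropositional as UDec
open import Data.Product using (_×_)
open import Relation.Binary.PropositionalEquality using (_≡_)
open import Relation.Nullary.Decidable using (⌊_⌋)
open import Data.Bool using (Bool; true; false; _∧_; _∨_)

-- A permutation of [n] is given by its one-line notation σ(1) … σ(n),
-- a vector of length n over Fin n (value k encodes k+1), with no repeats.
OneLine : ℕ → Set
OneLine n = Vec (Fin n) n

IsPerm : ∀ {n} → OneLine n → Set
IsPerm σ = Unique (toList σ)

allVecs : (n m : ℕ) → List (Vec (Fin n) m)
allVecs n zero = [] ∷ []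
allVecs n (suc m) = concatMap (λ x → map (x ∷_) (allVecs n m)) (allFin n)

Sym : (n : ℕ) → List (OneLine n)
Sym n = filter (λ σ → UDec.unique? (_≟_ {n}) (toList σ)) (allVecs n n)

lexLt : ∀ {n m} → Vec (Fin n) m → Vec (Fin n) m → Bool
lexLt [] [] = false
lexLt (x ∷ xs) (y ∷ ys) = ⌊ toℕ x <? toℕ y ⌋ ∨ (⌊ x ≟ y ⌋ ∧ lexLt xs ys)

rank : ∀ {n} → OneLine n → ℕ
rank {n} σ = suc (length (filter (λ τ → Data.Bool._≟_ (lexLt τ σ) true) (Sym n)))

lehmer : List ℕ → List ℕ
lehmer [] = []
lehmer (x ∷ xs) = length (filter (λ y → y <? x) xs) ∷ lehmer xs

-- Rotation condition on codes: position i (1-based) with suffix length m = n - i + 1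
-- must satisfy  c'_i ≡ c_i + 1 (mod m)
RotCode : List ℕ → List ℕ → Set
RotCode [] [] = Data.Unit.⊤ where import Data.Unit
RotCode [] (_ ∷ _) = Data.Empty.⊥ where import Data.Empty
RotCode (_ ∷ _) [] = Data.Empty.⊥ where import Data.Empty
RotCode (a ∷ as) (b ∷ bs) =
  (b % suc (length as) ≡ suc a % suc (length as)) × RotCode as bs

LehmerRot : ∀ {n} → OneLine n → OneLine n → Set
LehmerRot σ τ = IsPerm τ × RotCode (lehmer (map toℕ (toList σ))) (lehmer (map toℕ (toList τ)))

sumTo : ℕ → (ℕ → ℕ) → ℕ
sumTo zero f = 0
sumTo (suc k) f = sumTo k f + f k

-- Counting the permutations below σ position by position, each smaller value that is
-- still unused at position i admits (n − i)! completions, so rank σ = 1 + Σᵢ Lᵢ (n − i)!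
-- where L is the Lehmer code of σ. Along a rotation orbit the i-th Lehmer digit is a
-- residue modulo n − i + 1 that increases by one at each step, so a closed orbit runs
-- through every such residue cycle a whole number of times and the digit averages
-- (n − i)/2. Hence the rank averages 1 + ½ Σₘ m · m! = 1 + (n! − 1)/2 = (n! + 1)/2.
module Submission where

open import Defs
open import Data.Bool using (Bool; true; false; _∧_; if_then_else_)
import Data.Bool as Bool
open import Data.Bool.Properties using (∧-identityʳ; ∧-zeroʳ; ∨-identityʳ)
open import Data.Fin using (Fin; toℕ)
open import Data.Fin.Properties using (_≟_)
open import Data.List using (List; []; _∷_; _++_; length; map; filter; concatMap; allFin; drop)
open import Data.List.Properties
  using (map-++; map-cong; map-cong-local; length-tabulate; length-map; length-filter; ++-identityʳ)
open import Data.List.Membership.Propositional using (_∈_; _∉_)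
open import Data.List.Membership.Propositional.Properties using (∈-∃++; ∈-++⁺ˡ; ∈-++⁺ʳ; ∈-allFin)
open import Data.List.Membership.Propositional.Properties.WithK using (unique∧set⇒bag)
open import Data.List.Relation.Binary.BagAndSetEquality using (∼bag⇒↭)
open import Data.List.Relation.Binary.Permutation.Propositional using (_↭_; prep; ↭-sym; ↭-trans; ↭⇒↭ₛ)
open import Data.List.Relation.Binary.Permutation.Propositional.Properties
  using (map⁺; ++⁺ʳ; shift; ↭-length; ∈-resp-↭)
import Data.List.Relation.Binary.Permutation.Setoid.Properties as PermutationSetoid
open import Data.List.Relation.Binary.Subset.Propositional using (_⊆_)
import Data.List.Relation.Unary.All as All
open import Data.List.Relation.Unary.All.Properties using (¬Any⇒All¬)
open import Data.List.Relation.Unary.Any using (here; there)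
open import Data.List.Relation.Unary.Unique.Propositional using (Unique; []; _∷_)
open import Data.List.Relation.Unary.Unique.Propositional.Properties using (allFin⁺; Unique[x∷xs]⇒x∉xs)
open import Data.Nat using (ℕ; zero; suc; _+_; _*_; _∸_; _<_; _≤_; z≤n; s≤s; NonZero; _!)
open import Data.Nat.DivMod
open import Data.Nat.ListAction using (sum)
open import Data.Nat.ListAction.Properties using (sum-++; sum-↭)
open import Data.Nat.Properties hiding (_≟_)
open import Algebra.Properties.CommutativeSemigroup +-commutativeSemigroup using (interchange)
open import Data.Nat.Tactic.RingSolver using (solve-∀)
open import Data.Product using (∃; _×_; _,_; proj₁; proj₂)
open import Data.Unit using (⊤; tt)
open import Data.Vec using (Vec; []; _∷_; toList)
open import Data.Vec.Properties using (length-toList)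
open import Function using (_∘_; id; mk⇔)
open import Relation.Binary.PropositionalEquality
open ≡-Reasoning
open import Relation.Nullary using (yes; no; does; ¬_; contradiction)
open import Relation.Nullary.Decidable using (⌊_⌋; dec-true; dec-false; does-⇔; isYes≗does)
open import Relation.Unary using (Decidable)

sumTo-cong : ∀ k {f g : ℕ → ℕ} → (∀ {j} → j < k → f j ≡ g j) → sumTo k f ≡ sumTo k g
sumTo-cong zero    f≗g = refl
sumTo-cong (suc k) f≗g = cong₂ _+_ (sumTo-cong k (f≗g ∘ m<n⇒m<1+n)) (f≗g ≤-refl)

sumTo-+ : ∀ k (f g : ℕ → ℕ) → sumTo k (λ j → f j + g j) ≡ sumTo k f + sumTo k g
sumTo-+ zero    f g = refl
sumTo-+ (suc k) f g rewrite sumTo-+ k f g = interchange (sumTo k f) (sumTo k g) (f k) (g k)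

sumTo-*ʳ : ∀ k (f : ℕ → ℕ) c → sumTo k (λ j → f j * c) ≡ sumTo k f * c
sumTo-*ʳ zero    f c = refl
sumTo-*ʳ (suc k) f c rewrite sumTo-*ʳ k f c = sym (*-distribʳ-+ c (sumTo k f) (f k))

sumTo-const : ∀ k c → sumTo k (λ _ → c) ≡ k * c
sumTo-const zero    c = refl
sumTo-const (suc k) c rewrite sumTo-const k c = +-comm (k * c) c

sumTo-++ : ∀ a b (f : ℕ → ℕ) → sumTo (a + b) f ≡ sumTo a f + sumTo b (λ j → f (a + j))
sumTo-++ a zero    f rewrite +-identityʳ a = sym (+-identityʳ _)
sumTo-++ a (suc b) f rewrite +-suc a b | sumTo-++ a b f = +-assoc (sumTo a f) _ _

sumTo-rotate : ∀ k (f : ℕ → ℕ) → f k ≡ f 0 → sumTo k (f ∘ suc) ≡ sumTo k f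
sumTo-rotate k f fk≡f0 = +-cancelˡ-≡ (f 0) _ _ (begin
  f 0 + sumTo k (f ∘ suc)  ≡⟨ head+tail k ⟨
  sumTo (suc k) f          ≡⟨ cong (sumTo k f +_) fk≡f0 ⟩
  sumTo k f + f 0          ≡⟨ +-comm (sumTo k f) (f 0) ⟩
  f 0 + sumTo k f          ∎)
  where
  head+tail : ∀ k → sumTo (suc k) f ≡ f 0 + sumTo k (f ∘ suc)
  head+tail zero    = +-comm 0 (f 0)
  head+tail (suc k) rewrite head+tail k = +-assoc (f 0) _ _

gauss : ∀ m → 2 * sumTo m id + m ≡ m * m
gauss zero    = refl
gauss (suc m) = begin
  2 * (sumTo m id + m) + suc m      ≡⟨ regroup (sumTo m id) m ⟩
  (2 * sumTo m id + m) + 2 * m + 1  ≡⟨ cong (λ x → x + 2 * m + 1) (gauss m) ⟩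
  m * m + 2 * m + 1                 ≡⟨ square m ⟩
  suc m * suc m                     ∎
  where
  regroup : ∀ s m → 2 * (s + m) + suc m ≡ (2 * s + m) + 2 * m + 1
  regroup = solve-∀
  square : ∀ m → m * m + 2 * m + 1 ≡ suc m * suc m
  square = solve-∀

module _ {M : ℕ} .{{_ : NonZero M}} where

  %-cong-+ˡ : ∀ c {a b} → a % M ≡ b % M → (c + a) % M ≡ (c + b) % M
  %-cong-+ˡ c {a} {b} eq = begin
    (c + a) % M              ≡⟨ %-distribˡ-+ c a M ⟩
    (c % M + a % M) % M      ≡⟨ cong (λ x → (c % M + x) % M) eq ⟩
    (c % M + b % M) % M      ≡⟨ %-distribˡ-+ c b M ⟨
    (c + b) % M              ∎

  return⇒%≡0 : ∀ {a} k → a < M → (a + k) % M ≡ a → k % M ≡ 0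
  return⇒%≡0 {a} k a<M ret = begin
    k % M                     ≡⟨ [m+n]%n≡m%n k M ⟨
    (k + M) % M               ≡⟨ cong (_% M) reorder ⟩
    ((M ∸ a) + (a + k)) % M   ≡⟨ %-cong-+ˡ (M ∸ a) (trans ret (sym (m<n⇒m%n≡m a<M))) ⟩
    ((M ∸ a) + a) % M         ≡⟨ cong (_% M) (m∸n+n≡m (<⇒≤ a<M)) ⟩
    M % M                     ≡⟨ n%n≡0 M ⟩
    0                         ∎
    where
    reorder : k + M ≡ (M ∸ a) + (a + k)
    reorder = begin
      k + M              ≡⟨ cong (k +_) (m∸n+n≡m (<⇒≤ a<M)) ⟨
      k + ((M ∸ a) + a)  ≡⟨ +-comm k _ ⟩
      (M ∸ a) + a + k    ≡⟨ +-assoc (M ∸ a) a k ⟩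
      (M ∸ a) + (a + k)  ∎

  sumTo-residues : ∀ a → sumTo M (λ j → (a + j) % M) ≡ sumTo M id
  sumTo-residues zero    = sumTo-cong M m<n⇒m%n≡m
  sumTo-residues (suc a) = begin
    sumTo M (λ j → (suc a + j) % M)  ≡⟨ sumTo-cong M (λ {j} _ → cong (_% M) (+-suc a j)) ⟨
    sumTo M (residue ∘ suc)          ≡⟨ sumTo-rotate M residue wrap ⟩
    sumTo M residue                  ≡⟨ sumTo-residues a ⟩
    sumTo M id                       ∎
    where
    residue : ℕ → ℕ
    residue j = (a + j) % M
    wrap : residue M ≡ residue 0
    wrap = trans ([m+n]%n≡m%n a M) (cong (_% M) (sym (+-identityʳ a)))

  sumTo-periodic : ∀ (f : ℕ → ℕ) → (∀ j → f (M + j) ≡ f j) → ∀ q → sumTo (q * M) f ≡ q * sumTo M f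
  sumTo-periodic f period zero    = refl
  sumTo-periodic f period (suc q) = begin
    sumTo (M + q * M) f                               ≡⟨ sumTo-++ M (q * M) f ⟩
    sumTo M f + sumTo (q * M) (λ j → f (M + j))       ≡⟨ cong (sumTo M f +_) (sumTo-cong (q * M) (λ {j} _ → period j)) ⟩
    sumTo M f + sumTo (q * M) f                       ≡⟨ cong (sumTo M f +_) (sumTo-periodic f period q) ⟩
    sumTo M f + q * sumTo M f                         ∎

  cyclic-sumTo : (h : ℕ → ℕ) → (∀ j → h j < M) → (∀ j → h (suc j) % M ≡ suc (h j) % M)
               → ∀ k → h k ≡ h 0 → 2 * sumTo k h + k ≡ k * M
  cyclic-sumTo h h<M step k ret =
    subst (λ t → 2 * sumTo t h + t ≡ t * M) (sym k≡qM) (full-periods (k / M))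
    where
    h≡residue : ∀ j → h j ≡ (h 0 + j) % M
    h≡residue zero    = trans (sym (m<n⇒m%n≡m (h<M 0))) (cong (_% M) (sym (+-identityʳ (h 0))))
    h≡residue (suc j) = begin
      h (suc j)                  ≡⟨ m<n⇒m%n≡m (h<M (suc j)) ⟨
      h (suc j) % M              ≡⟨ step j ⟩
      suc (h j) % M              ≡⟨ %-cong-+ˡ 1 (trans (cong (_% M) (h≡residue j)) (m%n%n≡m%n _ M)) ⟩
      suc (h 0 + j) % M          ≡⟨ cong (_% M) (+-suc (h 0) j) ⟨
      (h 0 + suc j) % M          ∎
    k≡qM : k ≡ k / M * M
    k≡qM = trans (m≡m%n+[m/n]*n k M)
                 (cong (_+ k / M * M) (return⇒%≡0 k (h<M 0) (trans (sym (h≡residue k)) ret)))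
    full-periods : ∀ q → 2 * sumTo (q * M) h + q * M ≡ q * M * M
    full-periods q = begin
      2 * sumTo (q * M) h + q * M                     ≡⟨ cong (λ s → 2 * s + q * M) (sumTo-cong (q * M) (λ {j} _ → h≡residue j)) ⟩
      2 * sumTo (q * M) residue + q * M               ≡⟨ cong (λ s → 2 * s + q * M) (sumTo-periodic residue periodic q) ⟩
      2 * (q * sumTo M residue) + q * M               ≡⟨ cong (λ s → 2 * (q * s) + q * M) (sumTo-residues (h 0)) ⟩
      2 * (q * sumTo M id) + q * M                    ≡⟨ factor q (sumTo M id) M ⟩
      q * (2 * sumTo M id + M)                        ≡⟨ cong (q *_) (gauss M) ⟩
      q * (M * M)                                     ≡⟨ *-assoc q M M ⟨
      q * M * M                                       ∎
      where
      residue : ℕ → ℕ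
      residue j = (h 0 + j) % M
      periodic : ∀ j → residue (M + j) ≡ residue j
      periodic j = begin
        (h 0 + (M + j)) % M  ≡⟨ cong (λ x → (h 0 + x) % M) (+-comm M j) ⟩
        (h 0 + (j + M)) % M  ≡⟨ cong (_% M) (+-assoc (h 0) j M) ⟨
        (h 0 + j + M) % M    ≡⟨ [m+n]%n≡m%n (h 0 + j) M ⟩
        (h 0 + j) % M        ∎
      factor : ∀ q s M → 2 * (q * s) + q * M ≡ q * (2 * s + M)
      factor = solve-∀

factoradicValue : List ℕ → ℕ
factoradicValue []       = 0
factoradicValue (c ∷ cs) = c * length cs ! + factoradicValue cs

IsFactoradic : List ℕ → Set
IsFactoradic []       = ⊤
IsFactoradic (c ∷ cs) = c < suc (length cs) × IsFactoradic cs

length-lehmer : ∀ xs → length (lehmer xs) ≡ length xs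
length-lehmer []       = refl
length-lehmer (x ∷ xs) = cong suc (length-lehmer xs)

lehmer-isFactoradic : ∀ xs → IsFactoradic (lehmer xs)
lehmer-isFactoradic []       = tt
lehmer-isFactoradic (x ∷ xs) =
  s≤s (≤-trans (length-filter _ xs) (≤-reflexive (sym (length-lehmer xs)))) , lehmer-isFactoradic xs

rotation-orbit-sumTo : ∀ n (C : ℕ → List ℕ) → (∀ j → length (C j) ≡ n) → (∀ j → IsFactoradic (C j))
                     → (∀ j → RotCode (C j) (C (suc j))) → ∀ k → C k ≡ C 0
                     → 2 * sumTo k (factoradicValue ∘ C) + k ≡ k * n !
rotation-orbit-sumTo zero C len _ _ k _ = begin
  2 * sumTo k (factoradicValue ∘ C) + k  ≡⟨ cong (λ s → 2 * s + k) (sumTo-cong k (λ {j} _ → empty j)) ⟩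
  2 * sumTo k (λ _ → 0) + k              ≡⟨ cong (λ s → 2 * s + k) (trans (sumTo-const k 0) (*-zeroʳ k)) ⟩
  k                                      ≡⟨ *-identityʳ k ⟨
  k * 1                                  ∎
  where
  empty : ∀ j → factoradicValue (C j) ≡ 0
  empty j with C j | len j
  ... | [] | _ = refl
rotation-orbit-sumTo (suc n) C len fact rot k ret = begin
  2 * sumTo k (factoradicValue ∘ C) + k
    ≡⟨ cong (λ s → 2 * s + k) (sumTo-cong k (λ {j} _ → unfold j)) ⟩
  2 * sumTo k (λ j → h j * n ! + factoradicValue (T j)) + k
    ≡⟨ cong (λ s → 2 * s + k) (trans (sumTo-+ k _ _) (cong (_+ sumTo k (factoradicValue ∘ T)) (sumTo-*ʳ k h (n !)))) ⟩
  2 * (sumTo k h * n ! + sumTo k (factoradicValue ∘ T)) + k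
    ≡⟨ regroup (sumTo k h) (n !) (sumTo k (factoradicValue ∘ T)) k ⟩
  2 * sumTo k h * n ! + (2 * sumTo k (factoradicValue ∘ T) + k)
    ≡⟨ cong (2 * sumTo k h * n ! +_) tails ⟩
  2 * sumTo k h * n ! + k * n !
    ≡⟨ *-distribʳ-+ (n !) (2 * sumTo k h) k ⟨
  (2 * sumTo k h + k) * n !
    ≡⟨ cong (_* n !) leads ⟩
  k * suc n * n !
    ≡⟨ *-assoc k (suc n) (n !) ⟩
  k * suc n !
    ∎
  where
  lead : List ℕ → ℕ
  lead []      = 0
  lead (c ∷ _) = c
  h : ℕ → ℕ
  h j = lead (C j)
  T : ℕ → List ℕ
  T j = drop 1 (C j)
  C≡ : ∀ j → C j ≡ h j ∷ T j
  C≡ j with C j | len j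
  ... | _ ∷ _ | _ = refl
  lenT : ∀ j → length (T j) ≡ n
  lenT j = suc-injective (trans (cong length (sym (C≡ j))) (len j))
  unfold : ∀ j → factoradicValue (C j) ≡ h j * n ! + factoradicValue (T j)
  unfold j = trans (cong factoradicValue (C≡ j)) (cong (λ L → h j * L ! + factoradicValue (T j)) (lenT j))
  tails : 2 * sumTo k (factoradicValue ∘ T) + k ≡ k * n !
  tails = rotation-orbit-sumTo n T lenT (λ j → proj₂ (subst IsFactoradic (C≡ j) (fact j)))
            (λ j → proj₂ (subst₂ RotCode (C≡ j) (C≡ (suc j)) (rot j))) k (cong (drop 1) ret)
  leads : 2 * sumTo k h + k ≡ k * suc n
  leads = cyclic-sumTo h
    (λ j → subst (λ L → h j < suc L) (lenT j) (proj₁ (subst IsFactoradic (C≡ j) (fact j))))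
    (λ j → subst (λ L → h (suc j) % suc L ≡ suc (h j) % suc L) (lenT j)
                 (proj₁ (subst₂ RotCode (C≡ j) (C≡ (suc j)) (rot j))))
    k (cong lead ret)
  regroup : ∀ a f b k → 2 * (a * f + b) + k ≡ 2 * a * f + (2 * b + k)
  regroup = solve-∀

private
  variable
    A B : Set
    x : A
    xs ys : List A

count : (A → Bool) → List A → ℕ
count p []       = 0
count p (x ∷ xs) = if p x then suc (count p xs) else count p xs

length-filter≡count : ∀ {P : A → Set} (P? : Decidable P) xs → length (filter P? xs) ≡ count (does ∘ P?) xs
length-filter≡count P? []       = refl
length-filter≡count P? (x ∷ xs) with does (P? x)
... | true  = cong suc (length-filter≡count P? xs)
... | false = length-filter≡count P? xs

count-filter : ∀ {P : A → Set} (P? : Decidable P) (q : A → Bool) xs →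
               count q (filter P? xs) ≡ count (λ x → does (P? x) ∧ q x) xs
count-filter P? q []       = refl
count-filter P? q (x ∷ xs) with does (P? x)
... | false = count-filter P? q xs
... | true with q x
...   | true  = cong suc (count-filter P? q xs)
...   | false = count-filter P? q xs

count-cong : {p q : A → Bool} → (∀ x → p x ≡ q x) → ∀ xs → count p xs ≡ count q xs
count-cong p≗q []       = refl
count-cong p≗q (x ∷ xs) rewrite p≗q x | count-cong p≗q xs = refl

count-false : (xs : List A) → count (λ _ → false) xs ≡ 0
count-false []       = refl
count-false (x ∷ xs) = count-false xs

count-∧-const : ∀ (p : A → Bool) b xs → count (λ x → p x ∧ b) xs ≡ (if b then count p xs else 0)
count-∧-const p true  xs = count-cong (λ x → ∧-identityʳ (p x)) xs
count-∧-const p false xs = trans (count-cong (λ x → ∧-zeroʳ (p x)) xs) (count-false xs)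

count-++ : ∀ (p : A → Bool) xs ys → count p (xs ++ ys) ≡ count p xs + count p ys
count-++ p []       ys = refl
count-++ p (x ∷ xs) ys with p x
... | true  = cong suc (count-++ p xs ys)
... | false = count-++ p xs ys

count-map : ∀ (p : B → Bool) (f : A → B) xs → count p (map f xs) ≡ count (p ∘ f) xs
count-map p f []       = refl
count-map p f (x ∷ xs) with p (f x)
... | true  = cong suc (count-map p f xs)
... | false = count-map p f xs

count-concatMap : ∀ (p : B → Bool) (f : A → List B) xs →
                  count p (concatMap f xs) ≡ sum (map (count p ∘ f) xs)
count-concatMap p f []       = refl
count-concatMap p f (x ∷ xs) = trans (count-++ p (f x) (concatMap f xs)) (cong (count p (f x) +_) (count-concatMap p f xs))

sum-map-++ : ∀ (f : A → ℕ) xs ys → sum (map f (xs ++ ys)) ≡ sum (map f xs) + sum (map f ys)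
sum-map-++ f xs ys = trans (cong sum (map-++ f xs ys)) (sum-++ (map f xs) (map f ys))

sum-map-↭ : ∀ (f : A → ℕ) → xs ↭ ys → sum (map f xs) ≡ sum (map f ys)
sum-map-↭ f = sum-↭ ∘ map⁺ f

sum-map-cong-∈ : {f g : A → ℕ} → (∀ {x} → x ∈ xs → f x ≡ g x) → sum (map f xs) ≡ sum (map g xs)
sum-map-cong-∈ f≗g = cong sum (map-cong-local (All.tabulate f≗g))

sum-map-cong-const : ∀ {f : A → ℕ} {c} → (∀ {x} → x ∈ xs → f x ≡ c) → sum (map f xs) ≡ length xs * c
sum-map-cong-const {xs = []}     f≗c = refl
sum-map-cong-const {xs = x ∷ xs} f≗c = cong₂ _+_ (f≗c (here refl)) (sum-map-cong-const (f≗c ∘ there))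

sum-map-if : ∀ (p : A → Bool) c xs → sum (map (λ x → if p x then c else 0) xs) ≡ count p xs * c
sum-map-if p c []       = refl
sum-map-if p c (x ∷ xs) with p x
... | true  = cong (c +_) (sum-map-if p c xs)
... | false = sum-map-if p c xs

Unique-resp-↭ : Unique xs → xs ↭ ys → Unique ys
Unique-resp-↭ u p = PermutationSetoid.Unique-resp-↭ (setoid _) (↭⇒↭ₛ p) u

∈⇒↭∷ : x ∈ xs → ∃ λ ys → xs ↭ x ∷ ys
∈⇒↭∷ x∈xs with ys , zs , refl ← ∈-∃++ x∈xs = ys ++ zs , shift _ ys zs

Unique-++-∷⇒∉ : ∀ xs → Unique (xs ++ x ∷ ys) → x ∉ ys
Unique-++-∷⇒∉ xs u = Unique[x∷xs]⇒x∉xs (Unique-resp-↭ u (shift _ xs _)) ∘ ∈-++⁺ʳ xs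

Unique-⊆⇒length≤ : Unique xs → xs ⊆ ys → length xs ≤ length ys
Unique-⊆⇒length≤ []                 _   = z≤n
Unique-⊆⇒length≤ {xs = x ∷ xs} (x∉xs ∷ u) sub with ys′ , ys↭ ← ∈⇒↭∷ (sub (here refl)) =
  ≤-trans (s≤s (Unique-⊆⇒length≤ u xs⊆ys′)) (≤-reflexive (sym (↭-length ys↭)))
  where
  xs⊆ys′ : xs ⊆ ys′
  xs⊆ys′ z∈xs with ∈-resp-↭ ys↭ (sub (there z∈xs))
  ... | here refl = contradiction refl (All.lookup x∉xs z∈xs)
  ... | there z∈ys′ = z∈ys′

Unique⇒↭allFin : ∀ {n} {xs : List (Fin n)} → Unique xs → length xs ≡ n → xs ↭ allFin n
Unique⇒↭allFin {n} {xs} u len =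
  ∼bag⇒↭ (unique∧set⇒bag u (allFin⁺ n) (mk⇔ (λ _ → ∈-allFin _) (λ _ → covers _)))
  where
  open import Data.List.Membership.DecPropositional (_≟_ {n}) using (_∈?_)
  covers : ∀ x → x ∈ xs
  covers x with x ∈? xs
  ... | yes x∈xs = x∈xs
  ... | no  x∉xs = contradiction
    (Unique-⊆⇒length≤ (¬Any⇒All¬ xs x∉xs ∷ u) (λ {z} _ → ∈-allFin z))
    (subst₂ (λ k l → ¬ suc k ≤ l) (sym len) (sym (length-tabulate id)) 1+n≰n)

count-allVecs-suc : ∀ n m (p : Vec (Fin n) (suc m) → Bool) →
  count p (allVecs n (suc m)) ≡ sum (map (λ x → count (p ∘ (x ∷_)) (allVecs n m)) (allFin n))
count-allVecs-suc n m p = trans (count-concatMap p (λ x → map (x ∷_) (allVecs n m)) (allFin n))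
                            (cong sum (map-cong (λ x → count-map p (x ∷_) (allVecs n m)) (allFin n)))

lexLt-∷-≡ : ∀ {n m} (y : Fin n) (τ σ : Vec (Fin n) m) → lexLt (y ∷ τ) (y ∷ σ) ≡ lexLt τ σ
lexLt-∷-≡ y τ σ with toℕ y <? toℕ y | y ≟ y
... | yes y<y | _     = contradiction y<y (<-irrefl refl)
... | no _    | yes _ = refl
... | no _    | no y≢y = contradiction refl y≢y

lexLt-∷-≢ : ∀ {n m} {x y : Fin n} → x ≢ y → (τ σ : Vec (Fin n) m) → lexLt (x ∷ τ) (y ∷ σ) ≡ ⌊ toℕ x <? toℕ y ⌋
lexLt-∷-≢ {x = x} {y} x≢y τ σ with x ≟ y
... | yes x≡y = contradiction x≡y x≢y
... | no _    = ∨-identityʳ _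

lehmerCode : ∀ {n m} → Vec (Fin n) m → List ℕ
lehmerCode σ = lehmer (map toℕ (toList σ))

length-lehmerCode : ∀ {n m} (σ : Vec (Fin n) m) → length (lehmerCode σ) ≡ m
length-lehmerCode σ = trans (length-lehmer (map toℕ (toList σ))) (trans (length-map toℕ (toList σ)) (length-toList σ))

module _ {n : ℕ} where

  open import Data.List.Relation.Unary.Unique.DecPropositional (_≟_ {n}) using (unique?)

  fresh : ∀ {m} → List (Fin n) → Vec (Fin n) m → Bool
  fresh used τ = does (unique? (toList τ ++ used))

  fresh-∷ : ∀ {m} used x (τ : Vec (Fin n) m) → fresh used (x ∷ τ) ≡ fresh (x ∷ used) τ
  fresh-∷ used x τ = does-⇔ (mk⇔ (λ u → Unique-resp-↭ u (↭-sym (shift x (toList τ) used)))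
                                 (λ u → Unique-resp-↭ u (shift x (toList τ) used)))
                            (unique? _) (unique? _)

  fresh-∈ : ∀ {m} {used x} → x ∈ used → (τ : Vec (Fin n) m) → fresh (x ∷ used) τ ≡ false
  fresh-∈ x∈used τ = dec-false (unique? _) (λ u → Unique-++-∷⇒∉ (toList τ) u x∈used)

  count-fresh : ∀ m {rest used} → rest ++ used ↭ allFin n → length rest ≡ m →
                count (fresh used) (allVecs n m) ≡ m !
  count-fresh zero {[]} {used} partition refl
    rewrite dec-true (unique? used) (Unique-resp-↭ (allFin⁺ n) (↭-sym partition)) = refl
  count-fresh (suc m) {rest} {used} partition len = begin
    count (fresh used) (allVecs n (suc m))
      ≡⟨ count-allVecs-suc n m (fresh used) ⟩
    sum (map (λ x → count (fresh used ∘ (x ∷_)) (allVecs n m)) (allFin n))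
      ≡⟨ cong sum (map-cong (λ x → count-cong (fresh-∷ used x) (allVecs n m)) (allFin n)) ⟩
    sum (map extensions (allFin n))
      ≡⟨ sum-map-↭ extensions (↭-sym partition) ⟩
    sum (map extensions (rest ++ used))
      ≡⟨ sum-map-++ extensions rest used ⟩
    sum (map extensions rest) + sum (map extensions used)
      ≡⟨ cong₂ _+_ (sum-map-cong-const from-rest) (sum-map-cong-const from-used) ⟩
    length rest * m ! + length used * 0
      ≡⟨ cong₂ _+_ (cong (_* m !) len) (*-zeroʳ (length used)) ⟩
    suc m * m ! + 0
      ≡⟨ +-identityʳ _ ⟩
    suc m !
      ∎
    where
    extensions : Fin n → ℕ
    extensions x = count (fresh (x ∷ used)) (allVecs n m)
    from-rest : ∀ {x} → x ∈ rest → extensions x ≡ m !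
    from-rest {x} x∈rest with rest′ , rest↭ ← ∈⇒↭∷ x∈rest =
      count-fresh m (↭-trans (shift x rest′ used) (↭-trans (↭-sym (++⁺ʳ used rest↭)) partition))
                    (suc-injective (trans (sym (↭-length rest↭)) len))
    from-used : ∀ {x} → x ∈ used → extensions x ≡ 0
    from-used x∈used = trans (count-cong (fresh-∈ x∈used) (allVecs n m)) (count-false (allVecs n m))

  count-fresh-lexLt-∈ : ∀ {m} used {x y} (σ : Vec (Fin n) m) → y ∷ toList σ ++ used ↭ allFin n → x ∈ toList σ →
                        count (λ τ → fresh (x ∷ used) τ ∧ lexLt (x ∷ τ) (y ∷ σ)) (allVecs n m)
                          ≡ (if ⌊ toℕ x <? toℕ y ⌋ then m ! else 0)
  count-fresh-lexLt-∈ {m} used {x} {y} σ partition x∈σ with σ′ , σ↭ ← ∈⇒↭∷ x∈σ = begin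
    count (λ τ → fresh (x ∷ used) τ ∧ lexLt (x ∷ τ) (y ∷ σ)) (allVecs n m)
      ≡⟨ count-cong (λ τ → cong (fresh (x ∷ used) τ ∧_) (lexLt-∷-≢ x≢y τ σ)) (allVecs n m) ⟩
    count (λ τ → fresh (x ∷ used) τ ∧ below) (allVecs n m)
      ≡⟨ count-∧-const (fresh (x ∷ used)) below (allVecs n m) ⟩
    (if below then count (fresh (x ∷ used)) (allVecs n m) else 0)
      ≡⟨ cong (λ c → if below then c else 0) arrangements ⟩
    (if below then m ! else 0)
      ∎
    where
    below : Bool
    below = ⌊ toℕ x <? toℕ y ⌋
    x≢y : x ≢ y
    x≢y refl = Unique[x∷xs]⇒x∉xs (Unique-resp-↭ (allFin⁺ n) (↭-sym partition)) (∈-++⁺ˡ x∈σ)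
    arrangements : count (fresh (x ∷ used)) (allVecs n m) ≡ m !
    arrangements = count-fresh m {y ∷ σ′}
      (↭-trans (prep y (↭-trans (shift x σ′ used) (++⁺ʳ used (↭-sym σ↭)))) partition)
      (trans (↭-length (↭-sym σ↭)) (length-toList σ))

  count-fresh-lexLt : ∀ {m} used (σ : Vec (Fin n) m) → toList σ ++ used ↭ allFin n →
                      count (λ τ → fresh used τ ∧ lexLt τ σ) (allVecs n m) ≡ factoradicValue (lehmerCode σ)
  count-fresh-lexLt used [] _ rewrite ∧-zeroʳ (fresh used []) = refl
  count-fresh-lexLt {suc m} used (y ∷ σ) partition = begin
    count (λ τ → fresh used τ ∧ lexLt τ (y ∷ σ)) (allVecs n (suc m))
      ≡⟨ count-allVecs-suc n m _ ⟩
    sum (map (λ x → count (λ τ → fresh used (x ∷ τ) ∧ lexLt (x ∷ τ) (y ∷ σ)) (allVecs n m)) (allFin n))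
      ≡⟨ cong sum (map-cong (λ x → count-cong (λ τ → cong (_∧ _) (fresh-∷ used x τ)) (allVecs n m)) (allFin n)) ⟩
    sum (map smaller (allFin n))
      ≡⟨ sum-map-↭ smaller (↭-sym partition) ⟩
    smaller y + sum (map smaller (toList σ ++ used))
      ≡⟨ cong₂ _+_ from-y (sum-map-++ smaller (toList σ) used) ⟩
    v + (sum (map smaller (toList σ)) + sum (map smaller used))
      ≡⟨ cong₂ (λ a b → v + (a + b)) from-σ (sum-map-cong-const from-used) ⟩
    v + (count below (toList σ) * m ! + length used * 0)
      ≡⟨ reorder v (count below (toList σ) * m !) (length used) ⟩
    count below (toList σ) * m ! + v
      ≡⟨ cong₂ (λ c l → c * l ! + v) digit (sym (length-lehmerCode σ)) ⟩
    factoradicValue (lehmerCode (y ∷ σ))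
      ∎
    where
    v : ℕ
    v = factoradicValue (lehmerCode σ)
    smaller : Fin n → ℕ
    smaller x = count (λ τ → fresh (x ∷ used) τ ∧ lexLt (x ∷ τ) (y ∷ σ)) (allVecs n m)
    below : Fin n → Bool
    below x = ⌊ toℕ x <? toℕ y ⌋
    from-y : smaller y ≡ v
    from-y = trans (count-cong (λ τ → cong (fresh (y ∷ used) τ ∧_) (lexLt-∷-≡ y τ σ)) (allVecs n m))
                   (count-fresh-lexLt (y ∷ used) σ (↭-trans (shift y (toList σ) used) partition))
    from-σ : sum (map smaller (toList σ)) ≡ count below (toList σ) * m !
    from-σ = trans (sum-map-cong-∈ (count-fresh-lexLt-∈ used σ partition)) (sum-map-if below (m !) (toList σ))
    from-used : ∀ {x} → x ∈ used → smaller x ≡ 0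
    from-used x∈used = trans (count-cong (λ τ → cong (_∧ _) (fresh-∈ x∈used τ)) (allVecs n m))
                             (count-false (allVecs n m))
    digit : count below (toList σ) ≡ length (filter (_<? toℕ y) (map toℕ (toList σ)))
    digit = sym (begin
      length (filter (_<? toℕ y) (map toℕ (toList σ)))  ≡⟨ length-filter≡count (_<? toℕ y) (map toℕ (toList σ)) ⟩
      count (does ∘ (_<? toℕ y)) (map toℕ (toList σ))   ≡⟨ count-map _ toℕ (toList σ) ⟩
      count (λ x → does (toℕ x <? toℕ y)) (toList σ)    ≡⟨ count-cong (λ x → sym (isYes≗does (toℕ x <? toℕ y))) (toList σ) ⟩
      count below (toList σ)                            ∎)
    reorder : ∀ v c u → v + (c + u * 0) ≡ c + v
    reorder = solve-∀

rank≡suc-factoradicValue : ∀ {n} (σ : OneLine n) → IsPerm σ → rank σ ≡ suc (factoradicValue (lehmerCode σ))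
rank≡suc-factoradicValue {n} σ σ-perm = cong suc (begin
  length (filter (λ τ → lexLt τ σ Bool.≟ true) (Sym n))
    ≡⟨ length-filter≡count _ (Sym n) ⟩
  count (λ τ → does (lexLt τ σ Bool.≟ true)) (Sym n)
    ≡⟨ count-filter _ _ (allVecs n n) ⟩
  count (λ τ → does (unique? (toList τ)) ∧ does (lexLt τ σ Bool.≟ true)) (allVecs n n)
    ≡⟨ count-cong (λ τ → cong₂ _∧_ (cong (does ∘ unique?) (sym (++-identityʳ (toList τ)))) (does-≟true (lexLt τ σ))) (allVecs n n) ⟩
  count (λ τ → fresh [] τ ∧ lexLt τ σ) (allVecs n n)
    ≡⟨ count-fresh-lexLt [] σ (subst (_↭ allFin n) (sym (++-identityʳ (toList σ))) (Unique⇒↭allFin σ-perm (length-toList σ))) ⟩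
  factoradicValue (lehmerCode σ)
    ∎)
  where
  open import Data.List.Relation.Unary.Unique.DecPropositional (_≟_ {n}) using (unique?)
  does-≟true : ∀ b → does (b Bool.≟ true) ≡ b
  does-≟true true  = refl
  does-≟true false = refl

proposition4p41 : (n : ℕ) → 1 ≤ n → (orb : ℕ → OneLine n) → IsPerm (orb 0)
    → (∀ j → LehmerRot (orb j) (orb (suc j)))
    → (k : ℕ) → 0 < k → orb k ≡ orb 0 → (∀ j → 0 < j → j < k → ¬ (orb j ≡ orb 0))
    → 2 * sumTo k (λ j → rank (orb j)) ≡ k * (n ! + 1)
proposition4p41 n _ orb orb₀-perm rot k _ ret _ = begin
  2 * sumTo k (λ j → rank (orb j))
    ≡⟨ cong (2 *_) (sumTo-cong k (λ {j} _ → rank≡suc-factoradicValue (orb j) (orb-perm j))) ⟩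
  2 * sumTo k (λ j → suc (value j))
    ≡⟨ cong (2 *_) (sumTo-cong k (λ {j} _ → +-comm 1 (value j))) ⟩
  2 * sumTo k (λ j → value j + 1)
    ≡⟨ cong (2 *_) (trans (sumTo-+ k value (λ _ → 1)) (cong (sumTo k value +_) (trans (sumTo-const k 1) (*-identityʳ k)))) ⟩
  2 * (sumTo k value + k)
    ≡⟨ regroup (sumTo k value) k ⟩
  2 * sumTo k value + k + k
    ≡⟨ cong (_+ k) (rotation-orbit-sumTo n (lehmerCode ∘ orb) (length-lehmerCode ∘ orb) (lehmer-isFactoradic ∘ _)
                                          (proj₂ ∘ rot) k (cong lehmerCode ret)) ⟩
  k * n ! + k
    ≡⟨ distrib k (n !) ⟩
  k * (n ! + 1)
    ∎
  where
  value : ℕ → ℕ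
  value j = factoradicValue (lehmerCode (orb j))
  orb-perm : ∀ j → IsPerm (orb j)
  orb-perm zero    = orb₀-perm
  orb-perm (suc j) = proj₁ (rot j)
  regroup : ∀ s k → 2 * (s + k) ≡ 2 * s + k + k
  regroup = solve-∀
  distrib : ∀ k f → k * f + k ≡ k * (f + 1)
  distrib = solve-∀
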